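{- Let $\varphi$ be a safety LTL specification with deterministic safety automaton $\mathcal{A}=(Q,q_0,\delta,\Omega)$ and universal safety controller $\mathcal{U}$. Let $\mathcal{W}$ be an approximation of $\mathcal{U}$, let $\mathcal{U}'=(\mathcal{A},\kappa')$ be its learned prophecy controller (the output of $\mathtt{learnApprox}$ applied to $\mathcal{W}$), and let $\mathcal{M}_{\mathtt{p}}$ be a plant. Then the procedure $\mathsf{synthesize}(\mathcal{W},\mathcal{U}',\mathcal{M}_{\mathtt{p}})$ returns a controller $\mathcal{M}_{\mathtt{c}}$ such that $\mathcal{M}_{\mathtt{p}}\parallel\mathcal{M}_{\mathtt{c}}\models\varphi$.
   Context: Atomic propositions $\mathtt{AP}=O_{\mathtt{e}}\uplus O_{\mathtt{c}}\uplus O_{\mathtt{p}}$ are partitioned into the outputs of an environment $\mathtt{e}$, a controller $\mathtt{c}$ and a plant $\mathtt{p}$; inputs of process $i$ are $I_i=\bigcup_{j\neq i}O_j$; $\Sigma=2^{\mathtt{AP}}$. A strategy for process $i$ is a Moore machine $\mathcal{M}=(S,s_0,\tau,o)$ with finite $S$, $\tau\colon S\times 2^{I_i}\to S$, $o\colon S\to 2^{O_i}$; on inputs $\alpha_0\alpha_1\cdots$ it visits $s_0s_1\cdots$ with $s_{j+1}=\tau(s_j,\alpha_j)$ and outputs $o(s_0)o(s_1)\cdots$. $\mathit{Traces}(\mathcal{M})$ is the set of $\gamma\in\Sigma^\omega$ such that on input $(\gamma[j]\cap I_i)_j$ the machine outputs $(\gamma[j]\cap O_i)_j$; $\mathcal{M}\models\varphi$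 iff all its traces satisfy $\varphi$. $\mathcal{M}(s)$ is the machine with initial state $s$; $\mathit{out}(\mathcal{M},\epsilon)=o(s_0)$. $\mathbb{P}$, $\mathbb{C}$ are the sets of all plant, controller strategies. Parallel composition of $\mathcal{M}_i=(S_i,s^i_0,\tau_i,o_i)$, $\mathcal{M}_j=(S_j,s^j_0,\tau_j,o_j)$: states $S_i\times S_j$, initial $(s^i_0,s^j_0)$, inputs $(I_i\cup I_j)\setminus(O_i\cup O_j)$, outputs $O_i\cup O_j$, $\tau((s,s'),\sigma)=(\tau_i(s,(\sigma\cup o_j(s'))\cap I_i),\tau_j(s',(\sigma\cup o_i(s))\cap I_j))$, $o((s,s'))=o_i(s)\cup o_j(s')$. A deterministic safety automaton $\mathcal{A}=(Q,q_0,\delta,\Omega)$ has $\delta\colon Q\times\Sigma\to Q$ and $\Omega$ the set of state sequences staying in a set $F\subseteq Q$; $\mathcal{L}(\mathcal{A})=\mathcal{L}(\varphi)$. For a Moore machine $\mathcal{M}$ with outputs $O$, the product $\mathcal{A}\times\mathcal{M}$ has states $Q\times S$, initial $(q_0,s_0)$, partial transition $\delta'((q,s),\sigma)=(\delta(q,\sigma),\tau(s,\sigma))$ defined iff $\sigma\cap O=o(s)$. $\mathit{Runs}(\mathcal{A},q,\mathcal{M})$ is the set of runs of $\mathcal{A}$ from $q$ that are first components of runs of $\mathcal{A}\times\mathcal{M}$ from $(q,s_0)$. A prophecy controller is $(\mathcal{A},\kappa)$ with $\kappa\colon Q\times 2^{O_{\mathtt{c}}}\to 2^{\mathbb{P}}$.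 The universal safety controller (from prior work) is $\mathcal{U}=(\mathcal{A},\kappa)$ with $\kappa(q,\alpha)=\{\mathcal{M}_{\mathtt{p}}\in\mathbb{P}\mid\exists\mathcal{M}_{\mathtt{c}}\in\mathbb{C}.\ \mathit{out}(\mathcal{M}_{\mathtt{c}},\epsilon)=\alpha\wedge\mathit{Runs}(\mathcal{A},q,\mathcal{M}_{\mathtt{p}}\parallel\mathcal{M}_{\mathtt{c}})\subseteq\Omega\}$. An approximation of $\mathcal{U}$ is $(\mathcal{A},\underline{\kappa},\overline{\kappa})$ with $\underline{\kappa}(q,\alpha)\subseteq\kappa(q,\alpha)\subseteq\overline{\kappa}(q,\alpha)$ for all $q,\alpha$. $\mathtt{refine}(\mathcal{W},\mathcal{M}_{\mathtt{p}})$ with $\mathcal{M}_{\mathtt{p}}=(S^{\mathtt{p}},s^{\mathtt{p}}_0,\tau^{\mathtt{p}},o^{\mathtt{p}})$: form the game $G=\mathcal{A}\times\mathcal{M}_{\mathtt{p}}$ (controller chooses outputs in $O_{\mathtt{c}}$, environment in $O_{\mathtt{e}}$); compute the set $\mathit{Win}$ of states of $G$ from which the controller can ensure the run stays in $\Omega$; for every $q$, $s^{\mathtt{p}}$, $\alpha\subseteq O_{\mathtt{c}}$: if for every $\beta\subseteq O_{\mathtt{e}}$ the successor of $(q,s^{\mathtt{p}})$ under controller output $\alpha$ and environment output $\beta$ lies in $\mathit{Win}$, add $\mathcal{M}_{\mathtt{p}}(s^{\mathtt{p}})$ to $\underline{\kappa}(q,\alpha)$, else remove it from $\overline{\kappa}(q,\alpha)$.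 $\mathtt{learnCTL}(\mathit{Pos},\mathit{Neg})$ returns a CTL formula satisfied by every plant in $\mathit{Pos}$ and no plant in $\mathit{Neg}$. $\mathtt{learnApprox}(\mathcal{W},\mathit{Set})$: refine $\mathcal{W}$ successively with every plant of $\mathit{Set}$, obtaining $(\mathcal{A},\underline{\kappa}_r,\overline{\kappa}_r)$; for each $q,\alpha$ set $\kappa'(q,\alpha)$ to the set of plants satisfying $\mathtt{learnCTL}(\underline{\kappa}_r(q,\alpha),\mathbb{P}\setminus\overline{\kappa}_r(q,\alpha))$; return $(\mathcal{A},\kappa')$. $\mathtt{compose}((\mathcal{A},\kappa'),\mathcal{M}_{\mathtt{p}})$ with $\mathcal{M}_{\mathtt{p}}=(S,s_0,\tau,o)$ builds an explicit controller with states in $Q\times S$, initial state $(q_0,s_0)$, by breadth-first exploration from $(q_0,s_0)$: at an explored state $(q,s)$, iterate over $\alpha\subseteq O_{\mathtt{c}}$ and take the first $\alpha$ with $\mathcal{M}_{\mathtt{p}}(s)\in\kappa'(q,\alpha)$; set the output of $(q,s)$ to $\alpha$ and for every $\beta\subseteq I_{\mathtt{c}}$ add the transition from $(q,s)$ on $\beta$ to $(\delta(q,\alpha\cup\beta),\tau(s,(\alpha\cup\beta)\cap I_{\mathtt{p}}))$, enqueuing new states. $\mathsf{synthesize}(\mathcal{W},\mathcal{U}',\mathcal{M}_{\mathtt{p}})$: let $\mathcal{M}_{\mathtt{c}}=\mathtt{compose}(\mathcal{U}',\mathcal{M}_{\mathtt{p}})$; if $\mathit{Runs}(\mathcal{A},q_0,\mathcal{M}_{\mathtt{p}}\parallel\mathcal{M}_{\mathtt{c}})\subseteq\Omega$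 return $\mathcal{M}_{\mathtt{c}}$; otherwise set $\mathcal{U}'\gets\mathtt{learnApprox}(\mathcal{W},\{\mathcal{M}_{\mathtt{p}}\})$ and return $\mathtt{compose}(\mathcal{U}',\mathcal{M}_{\mathtt{p}})$.
   Formalization: The conclusion is drawn only for plants $\mathcal{M}_{\mathtt{p}}$ for which some controller in $\mathbb{C}$, composed in parallel with $\mathcal{M}_{\mathtt{p}}$, satisfies $\varphi$, so $\mathcal{M}_{\mathtt{p}}$ is assumed admissible. The statement above fails without it. -}

module Defs where

open import Data.Nat using (ℕ; zero; suc; _*_)
open import Data.Fin using (Fin; combine; quotRem)
open import Data.Fin.Subset using (Subset; inside; outside)
open import Data.Bool using (Bool; true; false)
open import Data.Vec using (Vec; []; _∷_; replicate)
open import Data.List using (List; []; _∷_; map; _++_; foldl)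
open import Data.Product using (Σ; ∃; _×_; _,_; proj₁; proj₂)
open import Data.Sum using (_⊎_)
open import Data.Empty using (⊥)
open import Data.Maybe using (Maybe; just; nothing)
open import Relation.Nullary using (¬_; Dec; yes; no)
open import Relation.Unary using (Pred)
open import Relation.Binary.PropositionalEquality using (_≡_)
open import Function using (_∘_)
import Data.Unit
import Data.Vec

record Moore (S I O : Set) : Set where
  field
    s₀ : S
    τ  : S → I → S
    o  : S → O

stateAt : ∀ {S I O} → Moore S I O → (ℕ → I) → ℕ → S
stateAt M ι zero    = Moore.s₀ M
stateAt M ι (suc j) = Moore.τ M (stateAt M ι j) (ι j)

-- Atomic propositions: O_e = Fin ne, O_c = Fin nc, O_p = Fin np.
-- A letter of Σ = 2^AP is a triple (env part, controller part, plant part).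

module _ {ne nc np : ℕ} where

  Letter : Set
  Letter = Subset ne × Subset nc × Subset np

  Trace : Set
  Trace = ℕ → Letter

  env : Letter → Subset ne
  env (e , c , p) = e
  ctl : Letter → Subset nc
  ctl (e , c , p) = c
  plt : Letter → Subset np
  plt (e , c , p) = p

  -- inputs of the plant: I_p = O_e ∪ O_c ; inputs of the controller: I_c = O_e ∪ O_p
  PlantIn : Set
  PlantIn = Subset ne × Subset nc
  CtrlIn : Set
  CtrlIn = Subset ne × Subset np

  IsTrace : ∀ {S I O} → Moore S I O → (Letter → I) → (Letter → O) → Trace → Set
  IsTrace M inp out γ = ∀ j → out (γ j) ≡ Moore.o M (stateAt M (inp ∘ γ) j)

  record Plant : Set where
    field
      n : ℕ
      M : Moore (Fin n) PlantIn (Subset np)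

  record Ctrl : Set where
    field
      n : ℕ
      M : Moore (Fin n) CtrlIn (Subset nc)

  plantFrom : (P : Plant) → Fin (Plant.n P) → Plant
  plantFrom P s = record { n = Plant.n P ; M = record (Plant.M P) { s₀ = s } }

  outε : Ctrl → Subset nc
  outε C = Moore.o (Ctrl.M C) (Moore.s₀ (Ctrl.M C))

  _∥_ : (P : Plant) (C : Ctrl) →
        Moore (Fin (Plant.n P) × Fin (Ctrl.n C)) (Subset ne) (Subset nc × Subset np)
  P ∥ C = record
    { s₀ = Moore.s₀ MP , Moore.s₀ MC
    ; τ  = λ { (s , s') e → Moore.τ MP s (e , Moore.o MC s') , Moore.τ MC s' (e , Moore.o MP s) }
    ; o  = λ { (s , s') → Moore.o MC s' , Moore.o MP s }
    }
    where
    MP = Plant.M P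
    MC = Ctrl.M C

  ClosedTraces : Plant → Ctrl → Trace → Set
  ClosedTraces P C = IsTrace (P ∥ C) env (λ σ → ctl σ , plt σ)

  data LTL : Set where
    tt   : LTL
    apE  : Fin ne → LTL
    apC  : Fin nc → LTL
    apP  : Fin np → LTL
    ¬L_  : LTL → LTL
    _∧L_ : LTL → LTL → LTL
    X    : LTL → LTL
    _U_  : LTL → LTL → LTL

  mem : ∀ {k} → Fin k → Subset k → Set
  mem i S = Data.Vec.lookup S i ≡ inside

  _,_⊨_ : Trace → ℕ → LTL → Set
  γ , i ⊨ tt       = Data.Unit.⊤
  γ , i ⊨ apE a    = mem a (env (γ i))
  γ , i ⊨ apC a    = mem a (ctl (γ i))
  γ , i ⊨ apP a    = mem a (plt (γ i))
  γ , i ⊨ (¬L φ)   = ¬ (γ , i ⊨ φ)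
  γ , i ⊨ (φ ∧L ψ) = (γ , i ⊨ φ) × (γ , i ⊨ ψ)
  γ , i ⊨ X φ      = γ , suc i ⊨ φ
  γ , i ⊨ (φ U ψ)  = ∃ λ k → (γ , (k Data.Nat.+ i) ⊨ ψ) ×
                             (∀ j → j Data.Nat.< k → γ , (j Data.Nat.+ i) ⊨ φ)

  _∥_⊨_ : Plant → Ctrl → LTL → Set
  P ∥ C ⊨ φ = ∀ γ → ClosedTraces P C γ → γ , 0 ⊨ φ

  -- Deterministic safety automata  A = (Q, q₀, δ, Ω), Q = Fin nq,
  -- Ω = state sequences staying in F.

  record SafetyAut : Set where
    field
      nq : ℕ
      q₀ : Fin nq
      δ  : Fin nq → Letter → Fin nq
      F  : Subset nq

  module _ (A : SafetyAut) where
    open SafetyAut A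

    runFrom : Fin nq → Trace → ℕ → Fin nq
    runFrom q γ zero    = q
    runFrom q γ (suc j) = δ (runFrom q γ j) (γ j)

    InΩ : (ℕ → Fin nq) → Set
    InΩ r = ∀ j → mem (r j) F

    Accepts : Trace → Set
    Accepts γ = InΩ (runFrom q₀ γ)

    -- Runs(A, q, M_p ∥ M_c) ⊆ Ω : the first components of the runs of the
    -- product A × (M_p ∥ M_c) from (q, initial state) are exactly the runs
    -- of A from q on traces of M_p ∥ M_c
    RunsSafe : Fin nq → Plant → Ctrl → Set
    RunsSafe q P C = ∀ γ → ClosedTraces P C γ → InΩ (runFrom q γ)

    κ : Fin nq → Subset nc → Pred Plant _
    κ q α P = ∃ λ (C : Ctrl) → outε C ≡ α × RunsSafe q P C

  record Approx (A : SafetyAut) : Set₁ where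
    field
      κlo : Fin (SafetyAut.nq A) → Subset nc → Pred Plant Agda.Primitive.lzero
      κhi : Fin (SafetyAut.nq A) → Subset nc → Pred Plant Agda.Primitive.lzero

  IsApprox : (A : SafetyAut) → Approx A → Set
  IsApprox A W = ∀ q α P →
    (Approx.κlo W q α P → κ A q α P) × (κ A q α P → Approx.κhi W q α P)

  module _ (A : SafetyAut) (Mp : Plant) where
    open SafetyAut A
    private
      S  = Fin (Plant.n Mp)
      MP = Plant.M Mp

    gsucc : Fin nq → S → Subset nc → Subset ne → Fin nq × S
    gsucc q s α β = δ q (β , α , Moore.o MP s) , Moore.τ MP s (β , α)

    Win : Fin nq × S → Set
    Win (q , s) = ∃ λ (C : Ctrl) → RunsSafe A q (plantFrom Mp s) C

    Good : Fin nq → S → Subset nc → Set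
    Good q s α = ∀ β → Win (gsucc q s α β)

    refine : Approx A → Approx A
    refine W = record
      { κlo = λ q α P → Approx.κlo W q α P ⊎ (∃ λ s → P ≡ plantFrom Mp s × Good q s α)
      ; κhi = λ q α P → Approx.κhi W q α P × ¬ (∃ λ s → P ≡ plantFrom Mp s × ¬ Good q s α)
      }

  -- The learner learnCTL, abstracted: a logic (formulas, satisfaction by
  -- plants, decidable model checking) with a learning function.

  record Learner : Set₁ where
    field
      Formula : Set
      _⊨F_    : Plant → Formula → Set
      _⊨?_    : ∀ P f → Dec (P ⊨F f)
      learn   : Pred Plant Agda.Primitive.lzero → Pred Plant Agda.Primitive.lzero → Formula

  LearnerSpec : Learner → Set₁
  LearnerSpec L = ∀ Pos Neg → (∀ P → Pos P → Neg P → ⊥) →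
    (∀ P → Pos P → P ⊨F learn Pos Neg) × (∀ P → Neg P → ¬ (P ⊨F learn Pos Neg))
    where open Learner L

  -- a learned prophecy controller (A, κ') : κ'(q,α) = {P | P ⊨ f q α}
  record Learned (L : Learner) (A : SafetyAut) : Set where
    field
      f : Fin (SafetyAut.nq A) → Subset nc → Learner.Formula L

  learnApprox : (L : Learner) (A : SafetyAut) → Approx A → List Plant → Learned L A
  learnApprox L A W Ps = record
    { f = λ q α → Learner.learn L (Approx.κlo Wr q α) (λ P → ¬ Approx.κhi Wr q α P) }
    where
    Wr = foldl (λ W' P → refine A P W') W Ps

  allSubsets : ∀ k → List (Subset k)
  allSubsets zero    = [] ∷ []
  allSubsets (suc k) = map (outside ∷_) (allSubsets k) ++ map (inside ∷_) (allSubsets k)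

  firstSat : (L : Learner) (A : SafetyAut) → Learned L A → Plant →
             Fin (SafetyAut.nq A) → List (Subset nc) → Maybe (Subset nc)
  firstSat L A Uc P q [] = nothing
  firstSat L A Uc P q (α ∷ αs) with Learner._⊨?_ L P (Learned.f Uc q α)
  ... | yes _ = just α
  ... | no  _ = firstSat L A Uc P q αs

  -- output at (q,s): the first α with M_p(s) ∈ κ'(q,α); if there is none
  -- (never the case on the states relevant for the corollary) output ∅
  composeOut : (L : Learner) (A : SafetyAut) → Learned L A → (Mp : Plant) →
               Fin (SafetyAut.nq A) → Fin (Plant.n Mp) → Subset nc
  composeOut L A Uc Mp q s with firstSat L A Uc (plantFrom Mp s) q (allSubsets nc)
  ... | just α  = α
  ... | nothing = replicate nc outside

  -- the explicit controller, states Q × S encoded as Fin (nq * n)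
  compose : (L : Learner) (A : SafetyAut) → Learned L A → Plant → Ctrl
  compose L A Uc Mp = record
    { n = SafetyAut.nq A * Plant.n Mp
    ; M = record
      { s₀ = combine (SafetyAut.q₀ A) (Moore.s₀ MP)
      ; τ  = λ k β → step (quotRem (Plant.n Mp) k) β
      ; o  = λ k → out (quotRem (Plant.n Mp) k)
      }
    }
    where
    MP = Plant.M Mp
    out : Fin (Plant.n Mp) × Fin (SafetyAut.nq A) → Subset nc
    out (s , q) = composeOut L A Uc Mp q s
    step : Fin (Plant.n Mp) × Fin (SafetyAut.nq A) → CtrlIn → Fin (SafetyAut.nq A * Plant.n Mp)
    step (s , q) (e , p) =
      combine (SafetyAut.δ A q (e , out (s , q) , p)) (Moore.τ MP s (e , out (s , q)))

  -- synthesize(W, U', M_p) returns M_c  (as a relation; the correctness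
  -- check Runs(A, q₀, M_p ∥ M_c) ⊆ Ω is stated, not computed)

  data SynthesizeReturns (L : Learner) (A : SafetyAut) (W : Approx A)
         (U' : Learned L A) (Mp : Plant) : Ctrl → Set where
    first  : RunsSafe A (SafetyAut.q₀ A) Mp (compose L A U' Mp) →
             SynthesizeReturns L A W U' Mp (compose L A U' Mp)
    second : ¬ RunsSafe A (SafetyAut.q₀ A) Mp (compose L A U' Mp) →
             SynthesizeReturns L A W U' Mp (compose L A (learnApprox L A W (Mp ∷ [])) Mp)

module Submission where

-- If synthesize returns its first candidate, that candidate passed the safety check. Otherwise
-- κ′ is relearned from M_p alone. For q ∈ F, refine puts M_p(s) into κ̲(q,α) iff every
-- environment move after output α leads to a winning game state, and removes it from κ̄(q,α)
-- otherwise; as W approximates κ and, on F, this condition is equivalent to M_p(s) ∈ κ(q,α),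
-- the two sets are disjoint and the learned formula separates them. From a winning state some
-- α is safe (the first output of a winning controller), so the composed controller finds an α
-- satisfying the learned formula, and every such α is safe: the game stays winning. The initial
-- state is winning because some controller realises φ, hence the run never leaves F.

open import Data.Bool.Properties using (_≟_)
open import Data.Empty using (⊥-elim)
open import Data.Fin using (Fin; combine; quotRem)
open import Data.Fin.Properties using (+↔⊎; 1↔⊤; remQuot-combine)
open import Data.Fin.Subset using (Subset; inside; outside)
open import Data.List using (List; []; _∷_; map)
open import Data.List.Membership.Propositional using (_∈_)
open import Data.List.Membership.Propositional.Properties using (∈-++⁺ˡ; ∈-++⁺ʳ; ∈-map⁺)
open import Data.List.Relation.Unary.Any using (here; there)
open import Data.Maybe using (just; nothing)
open import Data.Nat using (ℕ; zero; suc; _+_)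
open import Data.Product using (Σ; ∃; _×_; _,_; proj₁; proj₂; swap)
open import Data.Sum using (_⊎_; inj₁; inj₂)
open import Data.Sum.Function.Propositional using (_⊎-↔_)
open import Data.Unit using (⊤; tt)
open import Data.Vec using ([]; _∷_; replicate; lookup)
open import Effect.Monad using (RawMonad)
open import Function using (_∘_)
open import Function.Bundles using (_↔_; _⇔_; Inverse; Equivalence; mk↔ₛ′)
open import Function.Construct.Composition using (_↔-∘_)
open import Function.Construct.Symmetry using (↔-sym)
open import Level using (0ℓ)
open import Relation.Binary.PropositionalEquality
open import Relation.Nullary using (¬_; yes; no)
open import Relation.Nullary.Decidable using (decidable-stable)
open import Relation.Nullary.Negation using (¬¬-Monad; ¬¬-map)

open import Defs

open RawMonad (¬¬-Monad {a = 0ℓ}) using (pure; _>>=_)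

module _ {S I O : Set} where

  startAt : Moore S I O → S → Moore S I O
  startAt M s = record M { s₀ = s }

  stateAt-suc : ∀ (M : Moore S I O) ι j →
    stateAt M ι (suc j) ≡ stateAt (startAt M (Moore.τ M (Moore.s₀ M) (ι 0))) (ι ∘ suc) j
  stateAt-suc M ι zero    = refl
  stateAt-suc M ι (suc j) = cong (λ s → Moore.τ M s (ι (suc j))) (stateAt-suc M ι j)

record Bisimulation {S S′ I O : Set} (M : Moore S I O) (M′ : Moore S′ I O) : Set₁ where
  field
    _≈_  : S → S′ → Set
    ≈-s₀ : Moore.s₀ M ≈ Moore.s₀ M′
    ≈-τ  : ∀ {s s′} i → s ≈ s′ → Moore.τ M s i ≈ Moore.τ M′ s′ i
    ≈-o  : ∀ {s s′} → s ≈ s′ → Moore.o M s ≡ Moore.o M′ s′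

  stateAt-≈ : ∀ ι j → stateAt M ι j ≈ stateAt M′ ι j
  stateAt-≈ ι zero    = ≈-s₀
  stateAt-≈ ι (suc j) = ≈-τ (ι j) (stateAt-≈ ι j)

Σ-Subset-suc↔ : ∀ {k} (P : Subset (suc k) → Set) →
  Σ (Subset (suc k)) P ↔ (Σ (Subset k) (P ∘ (outside ∷_)) ⊎ Σ (Subset k) (P ∘ (inside ∷_)))
Σ-Subset-suc↔ P = mk↔ₛ′ split join (λ { (inj₁ _) → refl ; (inj₂ _) → refl }) join-split
  where
  split : Σ _ P → _
  split (outside ∷ v , x) = inj₁ (v , x)
  split (inside  ∷ v , x) = inj₂ (v , x)
  join : _ → Σ _ P
  join (inj₁ (v , x)) = outside ∷ v , x
  join (inj₂ (v , x)) = inside ∷ v , x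
  join-split : ∀ y → join (split y) ≡ y
  join-split (outside ∷ v , x) = refl
  join-split (inside  ∷ v , x) = refl

∑Subset : ∀ k → (Subset k → ℕ) → ℕ
∑Subset zero    n = n []
∑Subset (suc k) n = ∑Subset k (n ∘ (outside ∷_)) + ∑Subset k (n ∘ (inside ∷_))

Σ-Subset↔Fin : ∀ k (n : Subset k → ℕ) → Σ (Subset k) (Fin ∘ n) ↔ Fin (∑Subset k n)
Σ-Subset↔Fin zero    n = mk↔ₛ′ (λ { ([] , i) → i }) ([] ,_) (λ _ → refl) (λ { ([] , i) → refl })
Σ-Subset↔Fin (suc k) n =
  ↔-sym +↔⊎ ↔-∘ ((Σ-Subset↔Fin k _ ⊎-↔ Σ-Subset↔Fin k _) ↔-∘ Σ-Subset-suc↔ (Fin ∘ n))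

module _ {ne nc np : ℕ} where

  cons : Letter {ne} {nc} {np} → Trace → Trace
  cons x γ zero    = x
  cons x γ (suc j) = γ j

  module _ {S I O : Set} (inp : Letter {ne} {nc} {np} → I) (out : Letter {ne} {nc} {np} → O) where

    IsTrace-tail : ∀ (M : Moore S I O) {γ} → IsTrace M inp out γ →
      IsTrace (startAt M (Moore.τ M (Moore.s₀ M) (inp (γ 0)))) inp out (γ ∘ suc)
    IsTrace-tail M {γ} tr j = trans (tr (suc j)) (cong (Moore.o M) (stateAt-suc M (inp ∘ γ) j))

    IsTrace-cons : ∀ (M : Moore S I O) {x γ} → out x ≡ Moore.o M (Moore.s₀ M) →
      IsTrace (startAt M (Moore.τ M (Moore.s₀ M) (inp x))) inp out γ → IsTrace M inp out (cons x γ)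
    IsTrace-cons M         x-out _  zero    = x-out
    IsTrace-cons M {x} {γ} x-out tr (suc j) =
      trans (tr j) (sym (cong (Moore.o M) (stateAt-suc M (inp ∘ cons x γ) j)))

    IsTrace-bisim : ∀ {S′} {M : Moore S I O} {M′ : Moore S′ I O} {γ} → Bisimulation M M′ →
      IsTrace M inp out γ → IsTrace M′ inp out γ
    IsTrace-bisim {γ = γ} R tr j = trans (tr j) (≈-o (stateAt-≈ (inp ∘ γ) j))
      where open Bisimulation R

  ctrlFrom : (C : Ctrl {ne} {nc} {np}) → Fin (Ctrl.n C) → Ctrl
  ctrlFrom C c = record { n = Ctrl.n C ; M = startAt (Ctrl.M C) c }

  plantOutε : Plant {ne} {nc} {np} → Subset np
  plantOutε P = Moore.o (Plant.M P) (Moore.s₀ (Plant.M P))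

  plantAfter : Plant {ne} {nc} {np} → PlantIn {ne} {nc} {np} → Plant
  plantAfter P i = plantFrom P (Moore.τ (Plant.M P) (Moore.s₀ (Plant.M P)) i)

  ctrlAfter : Ctrl {ne} {nc} {np} → CtrlIn {ne} {nc} {np} → Ctrl
  ctrlAfter C i = ctrlFrom C (Moore.τ (Ctrl.M C) (Moore.s₀ (Ctrl.M C)) i)

  _≈ᶜ_ : Ctrl {ne} {nc} {np} → Ctrl {ne} {nc} {np} → Set₁
  C ≈ᶜ C′ = Bisimulation (Ctrl.M C) (Ctrl.M C′)

  ∥-congˡ : ∀ (P : Plant {ne} {nc} {np}) {C C′} → C ≈ᶜ C′ → Bisimulation (P ∥ C) (P ∥ C′)
  ∥-congˡ P R = record
    { _≈_  = λ { (s , c) (s′ , c′) → s ≡ s′ × c ≈ c′ }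
    ; ≈-s₀ = refl , ≈-s₀
    ; ≈-τ  = λ { e (refl , c≈c′) →
                 cong (λ a → Moore.τ (Plant.M P) _ (e , a)) (≈-o c≈c′) , ≈-τ _ c≈c′ }
    ; ≈-o  = λ { (refl , c≈c′) → cong (_, _) (≈-o c≈c′) }
    }
    where open Bisimulation R

  module _ {P : Plant {ne} {nc} {np}} {C : Ctrl {ne} {nc} {np}} where

    closedTraces-head : ∀ {γ} → ClosedTraces P C γ → γ 0 ≡ (env (γ 0) , outε C , plantOutε P)
    closedTraces-head {γ} tr = cong (env (γ 0) ,_) (tr 0)

    closedTraces-tail : ∀ {γ} → ClosedTraces P C γ →
      ClosedTraces (plantAfter P (env (γ 0) , outε C)) (ctrlAfter C (env (γ 0) , plantOutε P))
                   (γ ∘ suc)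
    closedTraces-tail = IsTrace-tail env (λ σ → ctl σ , plt σ) (P ∥ C)

    closedTraces-cons : ∀ {β γ} →
      ClosedTraces (plantAfter P (β , outε C)) (ctrlAfter C (β , plantOutε P)) γ →
      ClosedTraces P C (cons (β , outε C , plantOutε P) γ)
    closedTraces-cons = IsTrace-cons env (λ σ → ctl σ , plt σ) (P ∥ C) refl

    closedTrace : Σ Trace (ClosedTraces P C)
    closedTrace = γ , λ _ → refl
      where
      ∅ : Subset ne
      ∅ = replicate ne outside
      γ : Trace
      γ j = ∅ , Moore.o (P ∥ C) (stateAt (P ∥ C) (λ _ → ∅) j)

  module _ (A : SafetyAut {ne} {nc} {np}) where
    open SafetyAut A

    InF : Fin nq → Set
    InF q = mem {ne} {nc} {np} q F

    runFrom-suc : ∀ q γ j → runFrom A q γ (suc j) ≡ runFrom A (δ q (γ 0)) (γ ∘ suc) j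
    runFrom-suc q γ zero    = refl
    runFrom-suc q γ (suc j) = cong (λ q′ → δ q′ (γ (suc j))) (runFrom-suc q γ j)

    module _ {q : Fin nq} {P : Plant {ne} {nc} {np}} {C : Ctrl {ne} {nc} {np}} where

      RunsSafe⇒InF : RunsSafe A q P C → InF q
      RunsSafe⇒InF safe = safe _ (proj₂ (closedTrace {P} {C})) 0

      RunsSafeAfter : Subset ne → Set
      RunsSafeAfter β =
        RunsSafe A (δ q (β , outε C , plantOutε P)) (plantAfter P (β , outε C))
                   (ctrlAfter C (β , plantOutε P))

      RunsSafe⇒after : RunsSafe A q P C → ∀ β → RunsSafeAfter β
      RunsSafe⇒after safe β γ tr j =
        subst InF (runFrom-suc q _ j) (safe _ (closedTraces-cons {P} {C} tr) (suc j))

      after⇒RunsSafe : InF q → (∀ β → RunsSafeAfter β) → RunsSafe A q P C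
      after⇒RunsSafe q∈F _    _ _  zero    = q∈F
      after⇒RunsSafe _   safe γ tr (suc j) =
        subst InF (sym shift) (safe (env (γ 0)) (γ ∘ suc) (closedTraces-tail {P} {C} tr) j)
        where
        shift : runFrom A q γ (suc j) ≡ runFrom A (δ q (env (γ 0) , outε C , plantOutε P)) (γ ∘ suc) j
        shift = trans (runFrom-suc q γ j)
                      (cong (λ x → runFrom A (δ q x) (γ ∘ suc) j) (closedTraces-head {P} {C} tr))

      RunsSafe-bisim : ∀ {C′} → C′ ≈ᶜ C → RunsSafe A q P C → RunsSafe A q P C′
      RunsSafe-bisim R safe γ tr =
        safe γ (IsTrace-bisim env (λ σ → ctl σ , plt σ) (∥-congˡ P R) tr)

  module _ (α : Subset nc) (C : Subset ne → Ctrl {ne} {nc} {np}) where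

    BranchState : Set
    BranchState = ⊤ ⊎ Σ (Subset ne) (λ β → Fin (Ctrl.n (C β)))

    BranchState↔Fin : BranchState ↔ Fin (suc (∑Subset ne (Ctrl.n ∘ C)))
    BranchState↔Fin = ↔-sym +↔⊎ ↔-∘ (↔-sym 1↔⊤ ⊎-↔ Σ-Subset↔Fin ne (Ctrl.n ∘ C))

    open Inverse BranchState↔Fin using (to; from; strictlyInverseʳ)

    branchτ : BranchState → CtrlIn {ne} {nc} {np} → BranchState
    branchτ (inj₁ _)       (β , _) = inj₂ (β , Moore.s₀ (Ctrl.M (C β)))
    branchτ (inj₂ (β , c)) i       = inj₂ (β , Moore.τ (Ctrl.M (C β)) c i)

    branchO : BranchState → Subset nc
    branchO (inj₁ _)       = α
    branchO (inj₂ (β , c)) = Moore.o (Ctrl.M (C β)) c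

    branch : Ctrl
    branch = record
      { n = suc (∑Subset ne (Ctrl.n ∘ C))
      ; M = record { s₀ = to (inj₁ tt) ; τ = λ c i → to (branchτ (from c) i) ; o = branchO ∘ from }
      }

    outε-branch : outε branch ≡ α
    outε-branch = cong branchO (strictlyInverseʳ (inj₁ tt))

    branch-after : ∀ β x → ctrlAfter branch (β , x) ≈ᶜ C β
    branch-after β x = record
      { _≈_  = λ c c′ → from c ≡ inj₂ (β , c′)
      ; ≈-s₀ = trans (strictlyInverseʳ _)
                     (cong (λ s → branchτ s (β , x)) (strictlyInverseʳ (inj₁ tt)))
      ; ≈-τ  = λ i c≈ → trans (strictlyInverseʳ _) (cong (λ s → branchτ s i) c≈)
      ; ≈-o  = cong branchO
      }

    RunsSafe-branch : ∀ (A : SafetyAut) {q P} → InF A q →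
      (∀ β → RunsSafe A (SafetyAut.δ A q (β , α , plantOutε P)) (plantAfter P (β , α)) (C β)) →
      RunsSafe A q P branch
    RunsSafe-branch A {q} {P} q∈F safe = after⇒RunsSafe A {P = P} {branch} q∈F λ β →
      subst (λ a → RunsSafe A (SafetyAut.δ A q (β , a , plantOutε P)) (plantAfter P (β , a))
                     (ctrlAfter branch (β , plantOutε P)))
            (sym outε-branch)
            (RunsSafe-bisim A {P = plantAfter P (β , α)} (branch-after β (plantOutε P)) (safe β))

  module _ (A : SafetyAut {ne} {nc} {np}) (Mp : Plant {ne} {nc} {np}) where
    open SafetyAut A

    κ⇒Good : ∀ {q s α} → κ A q α (plantFrom Mp s) → Good A Mp q s α
    κ⇒Good {s = s} (C , refl , safe) β =
      ctrlAfter C (β , plantOutε (plantFrom Mp s)) , RunsSafe⇒after A {P = plantFrom Mp s} {C} safe β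

    Good⇒κ : ∀ {q s α} → InF A q → Good A Mp q s α → κ A q α (plantFrom Mp s)
    Good⇒κ {s = s} {α} q∈F good =
      branch α C , outε-branch α C , RunsSafe-branch α C A {P = plantFrom Mp s} q∈F (proj₂ ∘ good)
      where
      C : Subset ne → Ctrl
      C = proj₁ ∘ good

    Win⇒InF : ∀ {q s} → Win A Mp (q , s) → InF A q
    Win⇒InF {s = s} (C , safe) = RunsSafe⇒InF A {P = plantFrom Mp s} {C} safe

    follow : (Fin nq → Fin (Plant.n Mp) → Subset nc) → Fin nq × Fin (Plant.n Mp) → Subset ne →
             Fin nq × Fin (Plant.n Mp)
    follow σ (q , s) β = gsucc A Mp q s (σ q s) β

    Win-invariant : ∀ (σ : Fin nq → Fin (Plant.n Mp) → Subset nc) →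
      (∀ {q s} → Win A Mp (q , s) → ¬ ¬ Good A Mp q s (σ q s)) →
      ∀ (g : ℕ → Fin nq × Fin (Plant.n Mp)) (β : ℕ → Subset ne) →
      (∀ j → g (suc j) ≡ follow σ (g j) (β j)) → Win A Mp (g 0) → ∀ j → ¬ ¬ Win A Mp (g j)
    Win-invariant _ _      _ _ _         win₀ zero    = pure win₀
    Win-invariant σ σ-good g β g-follows win₀ (suc j) = do
      win  ← Win-invariant σ σ-good g β g-follows win₀ j
      good ← σ-good win
      pure (subst (Win A Mp) (sym (g-follows j)) (good (β j)))

    module _ {W : Approx A} (W-approx : IsApprox A W) {q : Fin nq} {α : Subset nc} where

      -- For q ∉ F, refine may add M_p(s) to κ̲(q,α) although κ(q,α) is empty.
      refine-lo⇒κ : InF A q → ∀ {P} → Approx.κlo (refine A Mp W) q α P → κ A q α P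
      refine-lo⇒κ _   (inj₁ lo)                = proj₁ (W-approx q α _) lo
      refine-lo⇒κ q∈F (inj₂ (s , refl , good)) = Good⇒κ q∈F good

      κ⇒refine-hi : ∀ {P} → κ A q α P → Approx.κhi (refine A Mp W) q α P
      κ⇒refine-hi κP = proj₂ (W-approx q α _) κP , λ { (_ , refl , ¬good) → ¬good (κ⇒Good κP) }

    module _ (L : Learner {ne} {nc} {np}) (L-spec : LearnerSpec L)
             {W : Approx A} (W-approx : IsApprox A W)
             {q : Fin nq} {s : Fin (Plant.n Mp)} {α : Subset nc} (q∈F : InF A q) where
      open Learner L

      private
        learned : Formula
        learned = Learned.f (learnApprox L A W (Mp ∷ [])) q α

        Wʳ : Approx A
        Wʳ = refine A Mp W

        separates : (∀ P → Approx.κlo Wʳ q α P → P ⊨F learned) ×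
                    (∀ P → ¬ Approx.κhi Wʳ q α P → ¬ P ⊨F learned)
        separates = L-spec (Approx.κlo Wʳ q α) (λ P → ¬ Approx.κhi Wʳ q α P) λ P lo ¬hi →
          ¬hi (κ⇒refine-hi W-approx (refine-lo⇒κ W-approx q∈F lo))

      Good⇒⊨learned : Good A Mp q s α → plantFrom Mp s ⊨F learned
      Good⇒⊨learned good = proj₁ separates _ (inj₂ (s , refl , good))

      ⊨learned⇒¬¬Good : plantFrom Mp s ⊨F learned → ¬ ¬ Good A Mp q s α
      ⊨learned⇒¬¬Good ⊨learned ¬good =
        proj₂ separates _ (λ (_ , no-bad) → no-bad (s , refl , ¬good)) ⊨learned

  allSubsets-complete : ∀ k (v : Subset k) → v ∈ allSubsets {ne} {nc} {np} k
  allSubsets-complete zero    []            = here refl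
  allSubsets-complete (suc k) (outside ∷ v) = ∈-++⁺ˡ (∈-map⁺ (outside ∷_) (allSubsets-complete k v))
  allSubsets-complete (suc k) (inside ∷ v)  =
    ∈-++⁺ʳ (map (outside ∷_) (allSubsets {ne} {nc} {np} k))
           (∈-map⁺ (inside ∷_) (allSubsets-complete k v))

  module _ (L : Learner {ne} {nc} {np}) (A : SafetyAut {ne} {nc} {np}) (U′ : Learned L A) where
    open Learner L
    open SafetyAut A

    private
      outputs : List (Subset nc)
      outputs = allSubsets {ne} {nc} {np} nc

    firstSat-sound : ∀ P q αs {α} → firstSat L A U′ P q αs ≡ just α → P ⊨F Learned.f U′ q α
    firstSat-sound P q (α′ ∷ αs) eq with P ⊨? Learned.f U′ q α′
    firstSat-sound P q (α′ ∷ αs) refl | yes ⊨α′ = ⊨α′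
    firstSat-sound P q (α′ ∷ αs) eq   | no  _   = firstSat-sound P q αs eq

    firstSat-complete : ∀ P q {αs α} → α ∈ αs → P ⊨F Learned.f U′ q α →
                        firstSat L A U′ P q αs ≢ nothing
    firstSat-complete P q {α′ ∷ αs} α∈          ⊨α eq with P ⊨? Learned.f U′ q α′
    firstSat-complete P q {α′ ∷ αs} α∈          ⊨α () | yes _
    firstSat-complete P q {α′ ∷ αs} (here refl) ⊨α eq | no ⊭α′ = ⊭α′ ⊨α
    firstSat-complete P q {α′ ∷ αs} (there α∈)  ⊨α eq | no _   = firstSat-complete P q α∈ ⊨α eq

    module _ (Mp : Plant {ne} {nc} {np}) where

      composeOut-⊨ : ∀ {q s α} → plantFrom Mp s ⊨F Learned.f U′ q α →
        plantFrom Mp s ⊨F Learned.f U′ q (composeOut L A U′ Mp q s)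
      composeOut-⊨ {q} {s} {α} ⊨α with firstSat L A U′ (plantFrom Mp s) q outputs in eq
      ... | just _  = firstSat-sound _ q outputs eq
      ... | nothing = ⊥-elim (firstSat-complete _ q (allSubsets-complete nc α) ⊨α eq)

      private
        MC = Ctrl.M (compose L A U′ Mp)
        MP = Plant.M Mp

      compose-o : ∀ {c s q} → quotRem (Plant.n Mp) c ≡ (s , q) →
                  Moore.o MC c ≡ composeOut L A U′ Mp q s
      compose-o = cong (λ (s , q) → composeOut L A U′ Mp q s)

      compose-τ : ∀ {c s q} e x → quotRem (Plant.n Mp) c ≡ (s , q) →
        let a = composeOut L A U′ Mp q s in
        quotRem (Plant.n Mp) (Moore.τ MC c (e , x)) ≡ (Moore.τ MP s (e , a) , δ q (e , a , x))
      compose-τ e x eq = trans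
        (cong (λ (s , q) → let a = composeOut L A U′ Mp q s in
                           quotRem (Plant.n Mp) (combine (δ q (e , a , x)) (Moore.τ MP s (e , a)))) eq)
        (cong swap (remQuot-combine _ _))

      module _ {γ : Trace} (tr : ClosedTraces Mp (compose L A U′ Mp) γ) where
        private
          st : ℕ → Fin (Plant.n Mp) × Fin (Ctrl.n (compose L A U′ Mp))
          st = stateAt (Mp ∥ compose L A U′ Mp) (env ∘ γ)

          plantState : ℕ → Fin (Plant.n Mp)
          plantState = proj₁ ∘ st

          autState : ℕ → Fin nq
          autState = runFrom A q₀ γ

          chosen : ℕ → Subset nc
          chosen j = composeOut L A U′ Mp (autState j) (plantState j)

        gameState : ℕ → Fin nq × Fin (Plant.n Mp)
        gameState j = autState j , plantState j

        compose-decodes : ∀ j → quotRem (Plant.n Mp) (proj₂ (st j)) ≡ (plantState j , autState j)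

        private
          outputs-chosen : ∀ j → Moore.o MC (proj₂ (st j)) ≡ chosen j
          outputs-chosen j = compose-o (compose-decodes j)

        compose-letter : ∀ j → γ j ≡ (env (γ j) , chosen j , Moore.o MP (plantState j))
        compose-letter j =
          cong (env (γ j) ,_) (trans (tr j) (cong (_, Moore.o MP (plantState j)) (outputs-chosen j)))

        compose-decodes zero    = cong swap (remQuot-combine q₀ (Moore.s₀ MP))
        compose-decodes (suc j) = trans (compose-τ (env (γ j)) _ (compose-decodes j))
          (sym (cong₂ _,_
            (cong (λ a → Moore.τ MP (plantState j) (env (γ j) , a)) (outputs-chosen j))
            (cong (δ (autState j)) (compose-letter j))))

        compose-plays : ∀ j →
          gameState (suc j) ≡ follow A Mp (composeOut L A U′ Mp) (gameState j) (env (γ j))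
        compose-plays j = cong₂ _,_ (cong (δ (autState j)) (compose-letter j))
          (cong (λ a → Moore.τ MP (plantState j) (env (γ j) , a)) (outputs-chosen j))

  module _ (L : Learner {ne} {nc} {np}) (L-spec : LearnerSpec L) (A : SafetyAut {ne} {nc} {np})
           {W : Approx A} (W-approx : IsApprox A W) (Mp : Plant {ne} {nc} {np}) where
    open SafetyAut A

    private
      U′ : Learned L A
      U′ = learnApprox L A W (Mp ∷ [])

    composeOut-good : ∀ {q s} → Win A Mp (q , s) → ¬ ¬ Good A Mp q s (composeOut L A U′ Mp q s)
    composeOut-good win@(C , safe) =
      ⊨learned⇒¬¬Good A Mp L L-spec W-approx q∈F (composeOut-⊨ L A U′ Mp ⊨first)
      where
      q∈F = Win⇒InF A Mp win
      ⊨first = Good⇒⊨learned A Mp L L-spec W-approx q∈F (κ⇒Good A Mp (C , refl , safe))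

    -- Learned formulas only exclude plants outside κ̄, so the invariant holds up to double
    -- negation; membership in F is decidable, which removes it.
    compose-safe : Win A Mp (q₀ , Moore.s₀ (Plant.M Mp)) → RunsSafe A q₀ Mp (compose L A U′ Mp)
    compose-safe win₀ γ tr j = decidable-stable (lookup F (runFrom A q₀ γ j) ≟ inside)
      (¬¬-map (Win⇒InF A Mp)
        (Win-invariant A Mp (composeOut L A U′ Mp) composeOut-good
          (gameState L A U′ Mp tr) (env ∘ γ) (compose-plays L A U′ Mp tr) win₀ j))

corollary2 : {ne nc np : ℕ}
    (L : Learner {ne} {nc} {np}) → LearnerSpec L →
    (φ : LTL {ne} {nc} {np}) (A : SafetyAut {ne} {nc} {np}) →
    (∀ γ → Accepts A γ ⇔ (γ , 0 ⊨ φ)) →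
    (W : Approx A) → IsApprox A W →
    (Ps : List Plant) (Mp : Plant) →
    (∃ λ (C : Ctrl) → Mp ∥ C ⊨ φ) →
    ∀ Mc → SynthesizeReturns L A W (learnApprox L A W Ps) Mp Mc → Mp ∥ Mc ⊨ φ
corollary2 _ _      _ _ A⇔φ _ _        _  _  _         _ (first safe) γ tr =
  Equivalence.to (A⇔φ γ) (safe γ tr)
corollary2 L L-spec _ A A⇔φ _ W-approx _  Mp (C , C⊨φ) _ (second _)   γ tr =
  Equivalence.to (A⇔φ γ) (compose-safe L L-spec A W-approx Mp win₀ γ tr)
  where
  win₀ : Win A Mp (SafetyAut.q₀ A , Moore.s₀ (Plant.M Mp))
  win₀ = C , λ γ′ tr′ → Equivalence.from (A⇔φ γ′) (C⊨φ γ′ tr′)
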